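{- Let $n\ge4$. Let $W_n$ be the directed wheel graph on vertices $v_1$ (the axle) and $v_2,\dots,v_n$ (the rim), in which the rim cycle $v_2,v_3,\dots,v_n,v_2$ consists of bi-directional arrows and each spoke $v_1v_i$ ($2\le i\le n$) is a bi-directional arrow; and let $W'_n$ be the directed graph on the same vertices with the same bi-directional rim arrows but with each spoke a one-directional arrow $v_i\to v_1$. Then $L_{W_n}$ and $L_{W'_n}$ are row equivalent over $\mathbb{Z}$. In particular, $\operatorname{Pic}(W_n)\cong\operatorname{Pic}(W'_n)$.
   Context: A bi-directional arrow between $u,w$ counts as an arrow from $u$ to $w$ and one from $w$ to $u$. The Laplacian $L_G$ of a directed graph on $v_1,\dots,v_n$ is the $n\times n$ integer matrix with $(i,i)$ entry the number of outgoing arrows of $v_i$ and $(i,j)$ entry ($i\ne j$) minus the number of arrows from $v_i$ to $v_j$. Row equivalent over $\mathbb{Z}$ means $L_{W'_n}=PL_{W_n}$ for some $P\in GL_n(\mathbb{Z})$. $\operatorname{Pic}(G)=\mathbb{Z}^n/L_G^T\mathbb{Z}^n$. -}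

module Defs where

open import Data.Nat using (ℕ; zero; suc; _≡ᵇ_)
open import Data.Bool using (Bool; true; false; if_then_else_; _∨_; _∧_)
open import Data.Fin using (Fin; zero; suc; toℕ; _≟_)
open import Data.Integer using (ℤ; +_; -_; _+_; _*_; _-_)
open import Data.Product using (Σ; ∃; _×_)
open import Function.Bundles using (_⇔_)
open import Relation.Nullary.Decidable using (does)
open import Relation.Binary.PropositionalEquality using (_≡_)

-- A directed (multi)graph on vertices Fin n is given by its arrow counts:
-- arrows i j = number of arrows from v_i to v_j.  A bi-directional arrow
-- between u and w contributes one arrow u → w and one arrow w → u.
DiGraph : ℕ → Set
DiGraph n = Fin n → Fin n → ℕ

Matrix : ℕ → Set
Matrix n = Fin n → Fin n → ℤ

Σℤ : ∀ {n} → (Fin n → ℤ) → ℤ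
Σℤ {zero}  f = + 0
Σℤ {suc n} f = f zero + Σℤ (λ i → f (suc i))

Σℕ : ∀ {n} → (Fin n → ℕ) → ℕ
Σℕ {zero}  f = 0
Σℕ {suc n} f = f zero Data.Nat.+ Σℕ (λ i → f (suc i))

outdeg : ∀ {n} → DiGraph n → Fin n → ℕ
outdeg G i = Σℕ (G i)

Laplacian : ∀ {n} → DiGraph n → Matrix n
Laplacian G i j = if does (i ≟ j) then + outdeg G i else - (+ G i j)

_·_ : ∀ {n} → Matrix n → Matrix n → Matrix n
(A · B) i k = Σℤ (λ j → A i j * B j k)

I : ∀ {n} → Matrix n
I i j = if does (i ≟ j) then + 1 else + 0

transpose : ∀ {n} → Matrix n → Matrix n
transpose A i j = A j i

InGL : ∀ {n} → Matrix n → Set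
InGL {n} P = Σ (Matrix n) λ Q → (∀ i j → (P · Q) i j ≡ I i j) × (∀ i j → (Q · P) i j ≡ I i j)

RowEquiv : ∀ {n} → Matrix n → Matrix n → Set
RowEquiv {n} A' A = Σ (Matrix n) λ P → InGL P × (∀ i j → A' i j ≡ (P · A) i j)

-- Pic(G) = ℤ^n / L_G^T ℤ^n.  Elements of ℤ^n are functions Fin n → ℤ.
-- x lies in the subgroup L_G^T ℤ^n
InImageLT : ∀ {n} → DiGraph n → (Fin n → ℤ) → Set
InImageLT {n} G x = ∃ λ (y : Fin n → ℤ) → ∀ j → x j ≡ Σℤ (λ k → transpose (Laplacian G) j k * y k)

-- Pic(G) ≅ Pic(H) as abelian groups: a group homomorphism f : ℤ^n → ℤ^n
-- inducing a well-defined, injective and surjective map on the quotients,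
-- i.e. x ∈ L_G^T ℤ^n ⇔ f x ∈ L_H^T ℤ^n, and every class of Pic(H) is hit.
PicIso : ∀ {n} → DiGraph n → DiGraph n → Set
PicIso {n} G H =
  Σ ((Fin n → ℤ) → (Fin n → ℤ)) λ f →
    (∀ (x y : Fin n → ℤ) j → f (λ i → x i + y i) j ≡ f x j + f y j)
    × (∀ (x : Fin n → ℤ) → InImageLT G x ⇔ InImageLT H (f x))
    × (∀ (z : Fin n → ℤ) → ∃ λ (x : Fin n → ℤ) → InImageLT H (λ j → z j - f x j))

-- Rim cycle on m vertices labelled 0..m-1 (v_2..v_n): i adjacent to i+1
-- and m-1 adjacent to 0.  Returns the number of arrows i → j (0 or 1).
rimAdj : (m : ℕ) → Fin m → Fin m → Bool
rimAdj m i j =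
  (toℕ j ≡ᵇ suc (toℕ i)) ∨ (toℕ i ≡ᵇ suc (toℕ j))
  ∨ ((toℕ i ≡ᵇ 0) ∧ (suc (toℕ j) ≡ᵇ m))
  ∨ ((toℕ j ≡ᵇ 0) ∧ (suc (toℕ i) ≡ᵇ m))

rim : (m : ℕ) → Fin m → Fin m → ℕ
rim m i j = if rimAdj m i j then 1 else 0

-- Vertex zero is the axle v_1; vertex suc k is the rim vertex v_{k+2}.
-- W_n: bi-directional rim arrows and bi-directional spokes.
Wheel : (n : ℕ) → DiGraph n
Wheel (suc m) zero    zero    = 0
Wheel (suc m) zero    (suc j) = 1
Wheel (suc m) (suc i) zero    = 1
Wheel (suc m) (suc i) (suc j) = rim m i j

Wheel' : (n : ℕ) → DiGraph n
Wheel' (suc m) zero    zero    = 0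
Wheel' (suc m) zero    (suc j) = 0
Wheel' (suc m) (suc i) zero    = 1
Wheel' (suc m) (suc i) (suc j) = rim m i j

-- Adding every row of L_{W_n} to the first row is an invertible integer row
-- operation.  Since W_n is symmetric and loopless, the columns of its Laplacian
-- sum to zero, so this operation turns the axle row into zero and leaves the
-- rim rows alone; that is exactly L_{W'_n}, whose axle has no outgoing arrows.
-- Row equivalence L' = P L gives L'ᵀ = Lᵀ Pᵀ with Pᵀ invertible, so Lᵀ and L'ᵀ
-- have the same image and the identity of ℤⁿ induces Pic(W_n) ≅ Pic(W'_n).
module Submission where

open import Defs
open import Data.Nat as ℕ using (ℕ; _≤_; zero; suc; s≤s; _≡ᵇ_)
open import Data.Bool using (Bool; false; if_then_else_; _∨_; _∧_)
open import Data.Bool.Properties using (∨-comm; ∨-commutativeMonoid)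
open import Algebra.Bundles using (CommutativeMonoid)
open import Data.Fin using (Fin; zero; suc; toℕ; _≟_)
open import Data.Integer using (ℤ; +_; -_; _+_; _*_; _-_)
open import Data.Integer.Properties
  using (+-*-semiring; +-identityˡ; +-identityʳ; +-inverseʳ; *-identityˡ; *-zeroˡ; *-zeroʳ;
         *-comm; *-assoc; neg-distrib-+; -1*i≡-i)
open import Algebra.Properties.Semiring.Sum +-*-semiring
  using (sum; ∑-comm; ∑-distrib-+; *-distribˡ-sum; *-distribʳ-sum)
open import Data.Product using (∃; _×_; _,_)
open import Function.Bundles using (mk⇔)
open import Algebra.Properties.CommutativeSemigroup (CommutativeMonoid.commutativeSemigroup ∨-commutativeMonoid)
  using (x∙yz≈y∙xz)
open import Relation.Nullary.Decidable using (yes; no)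
open import Relation.Binary.PropositionalEquality
  using (_≡_; refl; sym; trans; cong; cong₂; module ≡-Reasoning)

open ≡-Reasoning

private
  variable
    n : ℕ

Σℤ-cong : {f g : Fin n → ℤ} → (∀ i → f i ≡ g i) → Σℤ f ≡ Σℤ g
Σℤ-cong {zero}  f≗g = refl
Σℤ-cong {suc n} f≗g = cong₂ _+_ (f≗g zero) (Σℤ-cong (λ i → f≗g (suc i)))

Σℕ-cong : {f g : Fin n → ℕ} → (∀ i → f i ≡ g i) → Σℕ f ≡ Σℕ g
Σℕ-cong {zero}  f≗g = refl
Σℕ-cong {suc n} f≗g = cong₂ ℕ._+_ (f≗g zero) (Σℕ-cong (λ i → f≗g (suc i)))

Σℤ≡sum : (f : Fin n → ℤ) → Σℤ f ≡ sum f
Σℤ≡sum {zero}  f = refl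
Σℤ≡sum {suc n} f = cong (λ t → f zero + t) (Σℤ≡sum (λ i → f (suc i)))

Σℤ-zero : ∀ n → Σℤ {n} (λ _ → + 0) ≡ + 0
Σℤ-zero zero    = refl
Σℤ-zero (suc n) = trans (+-identityˡ _) (Σℤ-zero n)

Σℤ-distrib-+ : (f g : Fin n → ℤ) → Σℤ (λ i → f i + g i) ≡ Σℤ f + Σℤ g
Σℤ-distrib-+ f g = begin
  Σℤ (λ i → f i + g i)  ≡⟨ Σℤ≡sum (λ i → f i + g i) ⟩
  sum (λ i → f i + g i) ≡⟨ ∑-distrib-+ f g ⟩
  sum f + sum g         ≡⟨ cong₂ _+_ (Σℤ≡sum f) (Σℤ≡sum g) ⟨
  Σℤ f + Σℤ g           ∎

*-distribˡ-Σℤ : ∀ x (f : Fin n → ℤ) → x * Σℤ f ≡ Σℤ (λ i → x * f i)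
*-distribˡ-Σℤ x f = begin
  x * Σℤ f              ≡⟨ cong (x *_) (Σℤ≡sum f) ⟩
  x * sum f             ≡⟨ *-distribˡ-sum x f ⟩
  sum (λ i → x * f i)   ≡⟨ Σℤ≡sum (λ i → x * f i) ⟨
  Σℤ (λ i → x * f i)    ∎

*-distribʳ-Σℤ : ∀ x (f : Fin n → ℤ) → Σℤ f * x ≡ Σℤ (λ i → f i * x)
*-distribʳ-Σℤ x f = begin
  Σℤ f * x              ≡⟨ cong (_* x) (Σℤ≡sum f) ⟩
  sum f * x             ≡⟨ *-distribʳ-sum x f ⟩
  sum (λ i → f i * x)   ≡⟨ Σℤ≡sum (λ i → f i * x) ⟨
  Σℤ (λ i → f i * x)    ∎

Σℤ-comm : ∀ {m} (f : Fin m → Fin n → ℤ) →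
          Σℤ (λ i → Σℤ (λ j → f i j)) ≡ Σℤ (λ j → Σℤ (λ i → f i j))
Σℤ-comm f = begin
  Σℤ (λ i → Σℤ (f i))                 ≡⟨ Σℤ-cong (λ i → Σℤ≡sum (f i)) ⟩
  Σℤ (λ i → sum (f i))                ≡⟨ Σℤ≡sum (λ i → sum (f i)) ⟩
  sum (λ i → sum (f i))               ≡⟨ ∑-comm f ⟩
  sum (λ j → sum (λ i → f i j))       ≡⟨ Σℤ≡sum (λ j → sum (λ i → f i j)) ⟨
  Σℤ (λ j → sum (λ i → f i j))        ≡⟨ Σℤ-cong (λ j → Σℤ≡sum (λ i → f i j)) ⟨
  Σℤ (λ j → Σℤ (λ i → f i j))         ∎

Σℤ-neg : (g : Fin n → ℕ) → Σℤ (λ i → - (+ g i)) ≡ - (+ Σℕ g)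
Σℤ-neg {zero}  g = refl
Σℤ-neg {suc n} g = begin
  - (+ g zero) + Σℤ (λ i → - (+ g (suc i)))  ≡⟨ cong (λ t → - (+ g zero) + t) (Σℤ-neg (λ i → g (suc i))) ⟩
  - (+ g zero) + - (+ Σℕ (λ i → g (suc i)))  ≡⟨ neg-distrib-+ (+ g zero) _ ⟨
  - (+ Σℕ g)                                  ∎

Σℤ-bilinear-assoc : (u : Fin n → ℤ) (M : Fin n → Fin n → ℤ) (v : Fin n → ℤ) →
                    Σℤ (λ k → u k * Σℤ (λ l → M k l * v l)) ≡ Σℤ (λ l → Σℤ (λ k → u k * M k l) * v l)
Σℤ-bilinear-assoc u M v = begin
  Σℤ (λ k → u k * Σℤ (λ l → M k l * v l))    ≡⟨ Σℤ-cong (λ k → *-distribˡ-Σℤ (u k) (λ l → M k l * v l)) ⟩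
  Σℤ (λ k → Σℤ (λ l → u k * (M k l * v l)))  ≡⟨ Σℤ-cong (λ k → Σℤ-cong (λ l → *-assoc (u k) (M k l) (v l))) ⟨
  Σℤ (λ k → Σℤ (λ l → u k * M k l * v l))    ≡⟨ Σℤ-comm (λ k l → u k * M k l * v l) ⟩
  Σℤ (λ l → Σℤ (λ k → u k * M k l * v l))    ≡⟨ Σℤ-cong (λ l → *-distribʳ-Σℤ (v l) (λ k → u k * M k l)) ⟨
  Σℤ (λ l → Σℤ (λ k → u k * M k l) * v l)    ∎

Σℤ-δ : (i : Fin n) (f : Fin n → ℤ) → Σℤ (λ k → I i k * f k) ≡ f i
Σℤ-δ {suc n} zero f = begin
  + 1 * f zero + Σℤ (λ k → + 0 * f (suc k))  ≡⟨ cong₂ _+_ (*-identityˡ (f zero)) (Σℤ-cong (λ k → *-zeroˡ (f (suc k)))) ⟩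
  f zero + Σℤ {n} (λ _ → + 0)                 ≡⟨ cong (λ t → f zero + t) (Σℤ-zero n) ⟩
  f zero + + 0                                ≡⟨ +-identityʳ (f zero) ⟩
  f zero                                      ∎
Σℤ-δ {suc n} (suc i) f = trans (+-identityˡ _) (Σℤ-δ i (λ k → f (suc k)))

Σℤ-column-I : (j : Fin n) → Σℤ (λ k → I k j) ≡ + 1
Σℤ-column-I {suc n} zero = cong (λ t → + 1 + t) (Σℤ-zero n)
Σℤ-column-I {suc n} (suc j) = trans (+-identityˡ _) (Σℤ-column-I j)

·-identityˡ : (A : Matrix n) → ∀ i j → (I · A) i j ≡ A i j
·-identityˡ A i j = Σℤ-δ i (λ k → A k j)

·-assoc : (A B C : Matrix n) → ∀ i j → ((A · B) · C) i j ≡ (A · (B · C)) i j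
·-assoc A B C i j = sym (Σℤ-bilinear-assoc (A i) B (λ l → C l j))

RowEquiv-sym : {A B : Matrix n} → RowEquiv B A → RowEquiv A B
RowEquiv-sym {A = A} {B} (P , (Q , PQ≡I , QP≡I) , B≡PA) = Q , (P , QP≡I , PQ≡I) , A≡QB
  where
  A≡QB : ∀ i j → A i j ≡ (Q · B) i j
  A≡QB i j = begin
    A i j              ≡⟨ ·-identityˡ A i j ⟨
    (I · A) i j        ≡⟨ Σℤ-cong (λ k → cong (_* A k j) (QP≡I i k)) ⟨
    ((Q · P) · A) i j  ≡⟨ ·-assoc Q P A i j ⟩
    (Q · (P · A)) i j  ≡⟨ Σℤ-cong (λ k → cong (Q i k *_) (B≡PA k j)) ⟨
    (Q · B) i j        ∎

Imageᵀ : Matrix n → (Fin n → ℤ) → Set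
Imageᵀ {n} A x = ∃ λ (y : Fin n → ℤ) → ∀ j → x j ≡ Σℤ (λ k → transpose A j k * y k)

Imageᵀ-zero : (A : Matrix n) {x : Fin n → ℤ} → (∀ j → x j ≡ + 0) → Imageᵀ A x
Imageᵀ-zero {n} A {x} x≗0 = (λ _ → + 0) , λ j → begin
  x j                            ≡⟨ x≗0 j ⟩
  + 0                            ≡⟨ Σℤ-zero n ⟨
  Σℤ {n} (λ _ → + 0)             ≡⟨ Σℤ-cong (λ k → *-zeroʳ (A k j)) ⟨
  Σℤ (λ k → A k j * + 0)         ∎

RowEquiv⇒Imageᵀ-⊆ : {A B : Matrix n} → RowEquiv B A → ∀ {x} → Imageᵀ B x → Imageᵀ A x
RowEquiv⇒Imageᵀ-⊆ {A = A} {B} (P , _ , B≡PA) {x} (y , x≡Bᵀy) = Pᵀy , λ j → trans (x≡Bᵀy j) (Bᵀy≡AᵀPᵀy j)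
  where
  Pᵀy : Fin _ → ℤ
  Pᵀy l = Σℤ (λ k → P k l * y k)

  Bᵀy≡AᵀPᵀy : ∀ j → Σℤ (λ k → B k j * y k) ≡ Σℤ (λ l → A l j * Pᵀy l)
  Bᵀy≡AᵀPᵀy j = begin
    Σℤ (λ k → B k j * y k)                       ≡⟨ Σℤ-cong (λ k → trans (cong (_* y k) (B≡PA k j)) (*-comm ((P · A) k j) (y k))) ⟩
    Σℤ (λ k → y k * Σℤ (λ l → P k l * A l j))    ≡⟨ Σℤ-bilinear-assoc y P (λ l → A l j) ⟩
    Σℤ (λ l → Σℤ (λ k → y k * P k l) * A l j)    ≡⟨ Σℤ-cong (λ l → *-comm (Σℤ (λ k → y k * P k l)) (A l j)) ⟩
    Σℤ (λ l → A l j * Σℤ (λ k → y k * P k l))    ≡⟨ Σℤ-cong (λ l → cong (A l j *_) (Σℤ-cong (λ k → *-comm (y k) (P k l)))) ⟩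
    Σℤ (λ l → A l j * Pᵀy l)                     ∎

RowEquiv⇒PicIso : {G H : DiGraph n} → RowEquiv (Laplacian H) (Laplacian G) → PicIso G H
RowEquiv⇒PicIso {G = G} {H} LH~LG =
  (λ x → x) , (λ _ _ _ → refl) ,
  (λ x → mk⇔ (RowEquiv⇒Imageᵀ-⊆ {A = LH} {LG} (RowEquiv-sym LH~LG)) (RowEquiv⇒Imageᵀ-⊆ {A = LG} {LH} LH~LG)) ,
  (λ z → z , Imageᵀ-zero LH (λ j → +-inverseʳ (z j)))
  where
  LG LH : Matrix _
  LG = Laplacian G
  LH = Laplacian H

addRowsToHead : Matrix (suc n)
addRowsToHead zero    j = + 1
addRowsToHead (suc i) j = I (suc i) j

subtractRowsFromHead : Matrix (suc n)
subtractRowsFromHead zero    zero    = + 1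
subtractRowsFromHead zero    (suc j) = - (+ 1)
subtractRowsFromHead (suc i) j       = I (suc i) j

addRowsToHead-·-head : (A : Matrix (suc n)) → ∀ j → (addRowsToHead · A) zero j ≡ Σℤ (λ k → A k j)
addRowsToHead-·-head A j = Σℤ-cong (λ k → *-identityˡ (A k j))

subtractRowsFromHead-·-head : (A : Matrix (suc n)) → ∀ j →
  (subtractRowsFromHead · A) zero j ≡ A zero j - Σℤ (λ k → A (suc k) j)
subtractRowsFromHead-·-head A j =
  cong₂ _+_ (*-identityˡ (A zero j))
            (trans (sym (*-distribˡ-Σℤ (- (+ 1)) (λ k → A (suc k) j))) (-1*i≡-i _))

addRowsToHead-InGL : InGL {suc n} addRowsToHead
addRowsToHead-InGL {n} = Q , PQ≡I , QP≡I
  where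
  P Q : Matrix (suc n)
  P = addRowsToHead
  Q = subtractRowsFromHead

  PQ≡I : ∀ i j → (P · Q) i j ≡ I i j
  PQ≡I zero    zero    = trans (addRowsToHead-·-head Q zero) (cong (λ t → + 1 + t) (Σℤ-zero n))
  PQ≡I zero    (suc j) = trans (addRowsToHead-·-head Q (suc j)) (cong (λ t → - (+ 1) + t) (Σℤ-column-I j))
  PQ≡I (suc i) j       = ·-identityˡ Q (suc i) j

  QP≡I : ∀ i j → (Q · P) i j ≡ I i j
  QP≡I zero    zero    = trans (subtractRowsFromHead-·-head P zero) (cong (λ t → + 1 - t) (Σℤ-zero n))
  QP≡I zero    (suc j) = trans (subtractRowsFromHead-·-head P (suc j)) (cong (λ t → + 1 - t) (Σℤ-column-I j))
  QP≡I (suc i) j       = ·-identityˡ P (suc i) j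

RowEquiv-addRowsToHead : (A B : Matrix (suc n)) →
  (∀ j → B zero j ≡ Σℤ (λ k → A k j)) → (∀ i j → B (suc i) j ≡ A (suc i) j) → RowEquiv B A
RowEquiv-addRowsToHead A B head tail = addRowsToHead , addRowsToHead-InGL , B≡PA
  where
  B≡PA : ∀ i j → B i j ≡ (addRowsToHead · A) i j
  B≡PA zero    j = trans (head j) (sym (addRowsToHead-·-head A j))
  B≡PA (suc i) j = trans (tail i j) (sym (·-identityˡ A (suc i) j))

Laplacian-columnSum : (G : DiGraph n) → (∀ i j → G i j ≡ G j i) → (∀ i → G i i ≡ 0) →
                      ∀ j → Σℤ (λ k → Laplacian G k j) ≡ + 0
Laplacian-columnSum G G-sym G-irrefl j = begin
  Σℤ (λ k → Laplacian G k j)                           ≡⟨ Σℤ-cong entry ⟩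
  Σℤ (λ k → I k j * d + - (+ G k j))                   ≡⟨ Σℤ-distrib-+ (λ k → I k j * d) (λ k → - (+ G k j)) ⟩
  Σℤ (λ k → I k j * d) + Σℤ (λ k → - (+ G k j))       ≡⟨ cong₂ _+_ (sym (*-distribʳ-Σℤ d (λ k → I k j))) (Σℤ-neg (λ k → G k j)) ⟩
  Σℤ (λ k → I k j) * d + - (+ Σℕ (λ k → G k j))       ≡⟨ cong₂ (λ s t → s * d + - (+ t)) (Σℤ-column-I j) (Σℕ-cong (λ k → G-sym k j)) ⟩
  + 1 * d + - d                                        ≡⟨ cong (_+ - d) (*-identityˡ d) ⟩
  d + - d                                              ≡⟨ +-inverseʳ d ⟩
  + 0                                                  ∎
  where
  d : ℤ
  d = + outdeg G j

  entry : ∀ k → Laplacian G k j ≡ I k j * d + - (+ G k j)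
  entry k with k ≟ j
  ... | yes refl = begin
    d                    ≡⟨ *-identityˡ d ⟨
    + 1 * d              ≡⟨ +-identityʳ _ ⟨
    + 1 * d + + 0        ≡⟨ cong (λ t → + 1 * d + - (+ t)) (G-irrefl k) ⟨
    + 1 * d + - (+ G k k) ∎
  ... | no _ = sym (+-identityˡ _)

rim-sym : ∀ m i j → rim m i j ≡ rim m j i
rim-sym m i j = cong (λ b → if b then 1 else 0) (begin
  a ∨ b ∨ c ∨ d  ≡⟨ cong (λ t → a ∨ b ∨ t) (∨-comm c d) ⟩
  a ∨ b ∨ d ∨ c  ≡⟨ x∙yz≈y∙xz a b (d ∨ c) ⟩
  b ∨ a ∨ d ∨ c  ∎)
  where
  a b c d : Bool
  a = toℕ j ≡ᵇ suc (toℕ i)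
  b = toℕ i ≡ᵇ suc (toℕ j)
  c = (toℕ i ≡ᵇ 0) ∧ (suc (toℕ j) ≡ᵇ m)
  d = (toℕ j ≡ᵇ 0) ∧ (suc (toℕ i) ≡ᵇ m)

n≡ᵇ1+n : ∀ n → (n ≡ᵇ suc n) ≡ false
n≡ᵇ1+n zero    = refl
n≡ᵇ1+n (suc n) = n≡ᵇ1+n n

-- The rim on a single vertex is a loop, hence at least two rim vertices.
rim-irrefl : ∀ m (i : Fin (suc (suc m))) → rim (suc (suc m)) i i ≡ 0
rim-irrefl m zero    = refl
rim-irrefl m (suc i) rewrite n≡ᵇ1+n (toℕ i) = refl

Wheel-sym : ∀ n i j → Wheel n i j ≡ Wheel n j i
Wheel-sym (suc m) zero    zero    = refl
Wheel-sym (suc m) zero    (suc j) = refl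
Wheel-sym (suc m) (suc i) zero    = refl
Wheel-sym (suc m) (suc i) (suc j) = rim-sym m i j

Wheel-irrefl : ∀ m i → Wheel (suc (suc (suc m))) i i ≡ 0
Wheel-irrefl m zero    = refl
Wheel-irrefl m (suc i) = rim-irrefl m i

Laplacian-Wheel'-head : ∀ m j → Laplacian (Wheel' (suc m)) zero j ≡ + 0
Laplacian-Wheel'-head m zero    = cong +_ (Σℕ-zero m)
  where
  Σℕ-zero : ∀ n → Σℕ {n} (λ _ → 0) ≡ 0
  Σℕ-zero zero    = refl
  Σℕ-zero (suc n) = Σℕ-zero n
Laplacian-Wheel'-head m (suc j) = refl

Laplacian-Wheel'-tail : ∀ m i j → Laplacian (Wheel' (suc m)) (suc i) j ≡ Laplacian (Wheel (suc m)) (suc i) j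
Laplacian-Wheel'-tail m i zero    = refl
Laplacian-Wheel'-tail m i (suc j) = refl

proposition5p3 : (n : ℕ) → 4 ≤ n →
    RowEquiv (Laplacian (Wheel' n)) (Laplacian (Wheel n))
    × PicIso (Wheel n) (Wheel' n)
proposition5p3 n@(suc m@(suc (suc (suc k)))) (s≤s (s≤s (s≤s (s≤s _)))) =
  L'~L , RowEquiv⇒PicIso {G = Wheel n} {Wheel' n} L'~L
  where
  Lcolumns≡0 : ∀ j → Σℤ (λ k → Laplacian (Wheel n) k j) ≡ + 0
  Lcolumns≡0 = Laplacian-columnSum (Wheel n) (Wheel-sym n) (Wheel-irrefl (suc k))

  L'~L : RowEquiv (Laplacian (Wheel' n)) (Laplacian (Wheel n))
  L'~L = RowEquiv-addRowsToHead (Laplacian (Wheel n)) (Laplacian (Wheel' n))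
    (λ j → trans (Laplacian-Wheel'-head m j) (sym (Lcolumns≡0 j)))
    (Laplacian-Wheel'-tail m)
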